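{- For every even integer $k\ge 0$, $M_{k,\mathrm{T}\cdots\mathrm{F}}=\sqrt{2}^{\,k}$. For every odd integer $k\ge 1$, $1.5\,\sqrt{2}^{\,k-1}\le M_{k,\mathrm{T}\cdots\mathrm{F}}\le\sqrt{2}^{\,k+1}$.
   Context: Unordered CNF game: an instance is a pair $(\varphi,X)$ where $\varphi$ is a CNF formula (a set of clauses, each clause a disjunction of literals $x_i$ or $\overline{x}_i$) and $X$ is a finite set of boolean variables containing every variable appearing in $\varphi$ (and possibly more). Two players, T and F, alternate turns; on each turn the player picks a not-yet-assigned variable from $X$ and assigns it the value $0$ or $1$ of their choice. The game ends when all variables of $X$ are assigned; T wins if $\varphi$ is satisfied and F wins otherwise. If the same player moves first and last then $|X|$ is odd; if different players move first and last then $|X|$ is even. A CNF is $k$-uniform if every clause has exactly $k$ literals, on $k$ distinct variables. For $k\ge 0$ and $a,b\in\{\mathrm{T},\mathrm{F}\}$, $M_{k,a\cdots b}$ denotes the minimum number of clauses of $\varphi$ over all instances $(\varphi,X)$ with $\varphi$ $k$-uniform such that F has a winning strategy when player $a$ makes the first move and player $b$ makes the last move. -}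

module Defs where

open import Data.Nat using (ℕ; zero; suc; _*_; _≤_)
open import Data.Fin using (Fin; _≟_)
open import Data.Bool using (Bool; if_then_else_)
open import Data.Maybe using (Maybe; just; nothing)
open import Data.Product using (Σ; _×_; proj₁; _,_)
open import Data.List using (List; length)
open import Data.List.Relation.Unary.All using (All)
open import Data.List.Relation.Unary.Any using (Any)
open import Data.List.Relation.Unary.AllPairs using (AllPairs)
open import Data.List.Relation.Binary.Permutation.Propositional using (_↭_)
open import Relation.Nullary using (¬_; does)
open import Relation.Binary.PropositionalEquality using (_≡_; _≢_)

-- Variables of X are Fin n.  A literal is (variable , polarity):
-- (x , true) is x, (x , false) is the negation of x.
Lit : ℕ → Set
Lit n = Fin n × Bool

Clause : ℕ → Set
Clause n = List (Lit n)

CNF : ℕ → Set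
CNF n = List (Clause n)

Uniform : {n : ℕ} → ℕ → CNF n → Set
Uniform k φ = All (λ c → (length c ≡ k) × AllPairs (λ l l′ → proj₁ l ≢ proj₁ l′) c) φ

-- The CNF is a *set* of clauses: no clause is listed twice
-- (clauses equal as sets of literals, i.e. up to permutation, count once).
ClauseSet : {n : ℕ} → CNF n → Set
ClauseSet φ = AllPairs (λ c d → ¬ (c ↭ d)) φ

PAssign : ℕ → Set
PAssign n = Fin n → Maybe Bool

empty : {n : ℕ} → PAssign n
empty _ = nothing

assign : {n : ℕ} → PAssign n → Fin n → Bool → PAssign n
assign σ i b j = if does (j ≟ i) then just b else σ j

-- Satisfaction (used on complete assignments).
LitTrue : {n : ℕ} → PAssign n → Lit n → Set
LitTrue σ (x , b) = σ x ≡ just b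

Sat : {n : ℕ} → PAssign n → CNF n → Set
Sat σ φ = All (λ c → Any (LitTrue σ) c) φ

data Player : Set where
  T F : Player

-- FWins φ r p σ : in the position σ with r unassigned variables and
-- player p to move, player F has a winning strategy.
FWins : {n : ℕ} → CNF n → ℕ → Player → PAssign n → Set
FWins φ zero    _ σ = ¬ Sat σ φ
FWins {n} φ (suc r) F σ =
  Σ (Fin n) λ i → Σ Bool λ b → (σ i ≡ nothing) × FWins φ r T (assign σ i b)
FWins {n} φ (suc r) T σ =
  (i : Fin n) (b : Bool) → σ i ≡ nothing → FWins φ r F (assign σ i b)

-- An instance (φ , X) with φ k-uniform in which T moves first and F moves
-- last, i.e. |X| is even and positive: X = Fin (2 * suc m).
record InstanceTF (k : ℕ) : Set where
  field
    m        : ℕ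
    φ        : CNF (2 * suc m)
    uniform  : Uniform k φ
    clauseSet : ClauseSet φ

open InstanceTF public

size : {k : ℕ} → InstanceTF k → ℕ
size I = length (φ I)

FWinsTF : {k : ℕ} → InstanceTF k → Set
FWinsTF I = FWins (φ I) (2 * suc (m I)) T empty

IsMTF : ℕ → ℕ → Set
IsMTF k M =
  (Σ (InstanceTF k) λ I → FWinsTF I × size I ≡ M)
  × ((I : InstanceTF k) → FWinsTF I → M ≤ size I)

-- Lower bound: weigh every clause that is not yet satisfied by w(t), t its number of
-- unassigned literals, where 2·w(t) ≤ 3·w(t+1) and w(t) ≤ 2·w(t+2).  The pressure of a
-- literal is the total weight of the unsatisfied clauses containing it.  In each round T
-- sets the free literal l maximising pressure(l) − pressure(¬l); whatever F answers, the
-- total weight does not increase.  F wins only if some clause ends up falsified, and such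
-- a clause weighs w(0); hence w(0) ≤ |φ|·w(k).  With w(2s) = 3·2^(j−s), w(2s+1) = 2·2^(j−s)
-- this reads 2^j ≤ |φ| for k = 2j and 3·2^j ≤ 2|φ| for k = 2j+1.
--
-- Upper bound: with paired variables X_i, Y_i (1 ≤ i ≤ j) take the 2^j clauses
-- ⋁_i (X_i = s_i ∨ Y_i = ¬s_i), s ∈ {0,1}^j, and for odd k also add X_0 = s_0 to each,
-- which doubles the count.  F answers every move on X_i or Y_i by giving the partner the
-- opposite value; at the end the clause with s_i ≠ X_i for all i is falsified.

module Submission where

open import Defs
open import Data.Bool using (Bool; true; false; not; _∧_; if_then_else_)
open import Data.Bool.Properties using (not-¬; not-involutive) renaming (_≟_ to _≟ᵇ_)
open import Data.Fin using (Fin; zero; suc; _≟_; _↑ˡ_; _↑ʳ_; splitAt)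
open import Data.Fin.Properties using (splitAt-↑ˡ; splitAt-↑ʳ; splitAt⁻¹-↑ˡ; splitAt⁻¹-↑ʳ)
import Data.Fin.Properties as Fin
open import Data.Integer as ℤ using (ℤ)
import Data.Integer.Properties as ℤ
import Data.Integer.Tactic.RingSolver as ℤ-Solver
open import Data.List using (List; []; _∷_; length; map; _++_; filter; cartesianProduct; allFin; tabulate)
open import Data.List.Extrema ℤ.≤-totalOrder using (argmax; argmax-all; f[xs]≤f[argmax])
open import Data.List.Membership.Propositional using (_∈_; _∉_)
open import Data.List.Membership.Propositional.Properties
  using (∈-filter⁺; ∈-cartesianProduct⁺; ∈-allFin; ∈-++⁺ˡ; ∈-++⁺ʳ; ∈-++⁻; ∈-map⁺)
open import Data.List.Properties using (length-++; length-map; length-tabulate)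
open import Data.List.Relation.Binary.Permutation.Propositional.Properties using (∈-resp-↭)
open import Data.List.Relation.Unary.All as All using (All; []; _∷_)
open import Data.List.Relation.Unary.All.Properties using (All¬⇒¬Any; all-filter)
import Data.List.Relation.Unary.All.Properties as Allₚ
open import Data.List.Relation.Unary.AllPairs as AllPairs using (AllPairs; []; _∷_)
import Data.List.Relation.Unary.AllPairs.Properties as AllPairsₚ
open import Data.List.Relation.Unary.Any as Any using (Any; here; there; any?)
open import Data.Maybe using (just; nothing; is-nothing)
import Data.Maybe as Maybe
open import Data.Maybe.Properties using (just-injective) renaming (≡-dec to ≡-decₘ)
open import Data.Nat using (ℕ; zero; suc; _+_; _*_; _^_; _≤_; _<_; z≤n; s≤s; pred)
open import Data.Nat.ListAction using (sum)
open import Data.Nat.Properties hiding (_≟_)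
open import Data.Nat.Tactic.RingSolver using (solve-∀)
open import Data.Product using (Σ; ∃; _×_; proj₁; proj₂; _,_)
open import Data.Sum using (_⊎_; inj₁; inj₂; [_,_])
open import Function using (id; _∘_; case_of_)
open import Relation.Nullary using (¬_; Dec; yes; no; does; contradiction)
open import Relation.Nullary.Decidable using (dec-true; dec-false)
open import Relation.Binary.PropositionalEquality
  using (_≡_; _≢_; refl; sym; trans; cong; cong₂; subst; module ≡-Reasoning)

private variable
  n r : ℕ

bit : Bool → ℕ
bit false = 0
bit true = 1

-- FWins consumes one `suc` per move; unlike 2 * r, double (suc r) exposes both moves of a round.
double : ℕ → ℕ
double zero = zero
double (suc r) = suc (suc (double r))

2*≡double : ∀ r → 2 * r ≡ double r
2*≡double zero = refl
2*≡double (suc r) = cong suc (trans (+-suc r (r + 0)) (cong suc (2*≡double r)))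

+-exchange : ∀ a b c → a + (b + c) ≡ b + (a + c)
+-exchange = solve-∀

ℤ-diff-≤⇒ : ∀ a b c d → ℤ.+ a ℤ.- ℤ.+ b ℤ.≤ ℤ.+ c ℤ.- ℤ.+ d → d + a ≤ c + b
ℤ-diff-≤⇒ a b c d le = ℤ.drop‿+≤+ (begin
  ℤ.+ (d + a)                                   ≡⟨ ℤ.pos-+ d a ⟩
  ℤ.+ d ℤ.+ ℤ.+ a                               ≡⟨ shift (ℤ.+ a) (ℤ.+ b) (ℤ.+ d) ⟩
  (ℤ.+ a ℤ.- ℤ.+ b) ℤ.+ (ℤ.+ b ℤ.+ ℤ.+ d)       ≤⟨ ℤ.+-monoˡ-≤ (ℤ.+ b ℤ.+ ℤ.+ d) le ⟩
  (ℤ.+ c ℤ.- ℤ.+ d) ℤ.+ (ℤ.+ b ℤ.+ ℤ.+ d)       ≡⟨ unshift (ℤ.+ c) (ℤ.+ d) (ℤ.+ b) ⟩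
  ℤ.+ c ℤ.+ ℤ.+ b                               ≡⟨ ℤ.pos-+ c b ⟨
  ℤ.+ (c + b)                                   ∎)
  where
    open ℤ.≤-Reasoning
    shift : ∀ p q r → r ℤ.+ p ≡ (p ℤ.- q) ℤ.+ (q ℤ.+ r)
    shift = ℤ-Solver.solve-∀
    unshift : ∀ p r q → (p ℤ.- r) ℤ.+ (q ℤ.+ r) ≡ p ℤ.+ q
    unshift = ℤ-Solver.solve-∀

round-sum : {A : Set} (u v a a′ e e′ : A → ℕ) (xs : List A) →
  All (λ z → 2 * u z + (a z + a′ z) ≤ 2 * v z + (e z + e′ z)) xs →
  let ∑ f = sum (map f xs) in 2 * ∑ u + (∑ a + ∑ a′) ≤ 2 * ∑ v + (∑ e + ∑ e′)
round-sum u v a a′ e e′ [] [] = z≤n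
round-sum {A} u v a a′ e e′ (z ∷ xs) (le ∷ les) = begin
  2 * (u z + ∑ u) + ((a z + ∑ a) + (a′ z + ∑ a′))       ≡⟨ regroup (u z) (∑ u) (a z) (∑ a) (a′ z) (∑ a′) ⟩
  (2 * u z + (a z + a′ z)) + (2 * ∑ u + (∑ a + ∑ a′))   ≤⟨ +-mono-≤ le (round-sum u v a a′ e e′ xs les) ⟩
  (2 * v z + (e z + e′ z)) + (2 * ∑ v + (∑ e + ∑ e′))   ≡⟨ regroup (v z) (∑ v) (e z) (∑ e) (e′ z) (∑ e′) ⟨
  2 * (v z + ∑ v) + ((e z + ∑ e) + (e′ z + ∑ e′))       ∎
  where
    open ≤-Reasoning
    ∑ : (A → ℕ) → ℕ
    ∑ f = sum (map f xs)
    regroup : ∀ p P q Q q′ Q′ → 2 * (p + P) + ((q + Q) + (q′ + Q′)) ≡ (2 * p + (q + q′)) + (2 * P + (Q + Q′))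
    regroup = solve-∀

assign-self : (σ : PAssign n) (i : Fin n) (b : Bool) → assign σ i b i ≡ just b
assign-self σ i b rewrite dec-true (i ≟ i) refl = refl

assign-other : (σ : PAssign n) (i : Fin n) (b : Bool) {j : Fin n} → j ≢ i → assign σ i b j ≡ σ j
assign-other σ i b {j} j≢i rewrite dec-false (j ≟ i) j≢i = refl

assign-other₂ : (σ : PAssign n) {u v w : Fin n} {a b : Bool} → w ≢ u → w ≢ v →
                assign (assign σ u a) v b w ≡ σ w
assign-other₂ σ {u} {v} {a = a} {b} w≢u w≢v =
  trans (assign-other (assign σ u a) v b w≢v) (assign-other σ u a w≢u)

assign-free⁻ : (σ : PAssign n) (i : Fin n) (b : Bool) {j : Fin n} → assign σ i b j ≡ nothing → σ j ≡ nothing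
assign-free⁻ σ i b {j} free with j ≟ i
... | yes refl = case free of λ ()
... | no _ = free

countTrue : (Fin n → Bool) → ℕ
countTrue {zero} f = 0
countTrue {suc n} f = bit (f zero) + countTrue (f ∘ suc)

countTrue-cong : (f g : Fin n → Bool) → (∀ i → f i ≡ g i) → countTrue f ≡ countTrue g
countTrue-cong {zero} f g f≗g = refl
countTrue-cong {suc n} f g f≗g rewrite f≗g zero =
  cong (bit (g zero) +_) (countTrue-cong (f ∘ suc) (g ∘ suc) (f≗g ∘ suc))

countTrue-flip : (f g : Fin n → Bool) (i : Fin n) → f i ≡ true → g i ≡ false →
                 (∀ j → j ≢ i → g j ≡ f j) → countTrue f ≡ suc (countTrue g)
countTrue-flip {suc n} f g zero fi gi rest rewrite fi | gi =
  cong suc (countTrue-cong (f ∘ suc) (g ∘ suc) (λ j → sym (rest (suc j) λ ())))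
countTrue-flip {suc n} f g (suc i) fi gi rest rewrite rest zero (λ ()) =
  trans (cong (bit (f zero) +_)
               (countTrue-flip (f ∘ suc) (g ∘ suc) i fi gi (λ j j≢i → rest (suc j) (j≢i ∘ Fin.suc-injective))))
        (+-suc (bit (f zero)) _)

countTrue-suc⇒∃ : (f : Fin n → Bool) {c : ℕ} → countTrue f ≡ suc c → ∃ λ i → f i ≡ true
countTrue-suc⇒∃ {suc n} f eq with f zero in fz
... | true = zero , fz
... | false with countTrue-suc⇒∃ (f ∘ suc) eq
... | i , fi = suc i , fi

countTrue-zero⇒ : (f : Fin n → Bool) → countTrue f ≡ 0 → ∀ i → f i ≡ false
countTrue-zero⇒ {suc n} f eq i with f zero in fz
countTrue-zero⇒ {suc n} f eq zero    | false = fz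
countTrue-zero⇒ {suc n} f eq (suc i) | false = countTrue-zero⇒ (f ∘ suc) eq i

countTrue-const : countTrue {n} (λ _ → true) ≡ n
countTrue-const {zero} = refl
countTrue-const {suc n} = cong suc (countTrue-const {n})

freeCount : PAssign n → ℕ
freeCount σ = countTrue (is-nothing ∘ σ)

freeCount-empty : freeCount (empty {n}) ≡ n
freeCount-empty = countTrue-const

freeCount-assign : (σ : PAssign n) (i : Fin n) (b : Bool) → σ i ≡ nothing →
                   freeCount σ ≡ suc (freeCount (assign σ i b))
freeCount-assign σ i b free = countTrue-flip _ _ i (cong is-nothing free) (cong is-nothing (assign-self σ i b))
  (λ j j≢i → cong is-nothing (assign-other σ i b j≢i))

freeCount-round : (σ : PAssign n) {x y : Fin n} {b c : Bool} → freeCount σ ≡ double (suc r) →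
                  σ x ≡ nothing → assign σ x b y ≡ nothing → freeCount (assign (assign σ x b) y c) ≡ double r
freeCount-round {r = r} σ {x} {y} {b} {c} count x-free y-free = suc-injective (suc-injective (begin
  suc (suc (freeCount (assign (assign σ x b) y c))) ≡⟨ cong suc (freeCount-assign (assign σ x b) y c y-free) ⟨
  suc (freeCount (assign σ x b))                    ≡⟨ freeCount-assign σ x b x-free ⟨
  freeCount σ                                       ≡⟨ count ⟩
  double (suc r)                                    ∎))
  where open ≡-Reasoning

freeCount-suc⇒free : (σ : PAssign n) {c : ℕ} → freeCount σ ≡ suc c → ∃ λ i → σ i ≡ nothing
freeCount-suc⇒free σ count with countTrue-suc⇒∃ (is-nothing ∘ σ) count
... | i , free with σ i in σi
... | nothing = i , σi
... | just _ = case free of λ ()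

Distinct : Clause n → Set
Distinct = AllPairs (λ l l′ → proj₁ l ≢ proj₁ l′)

neg : Lit n → Lit n
neg (x , b) = x , not b

varCount : Fin n → Clause n → ℕ
varCount x [] = 0
varCount x ((z , _) ∷ c) = bit (does (z ≟ x)) + varCount x c

litCount : Lit n → Clause n → ℕ
litCount (x , b) [] = 0
litCount (x , b) ((z , d) ∷ c) = bit (does (z ≟ x) ∧ does (d ≟ᵇ b)) + litCount (x , b) c

freeLitCount : PAssign n → Clause n → ℕ
freeLitCount σ [] = 0
freeLitCount σ ((z , _) ∷ c) = bit (is-nothing (σ z)) + freeLitCount σ c

varCount-split : (x : Fin n) (b : Bool) (c : Clause n) → varCount x c ≡ litCount (x , b) c + litCount (x , not b) c
varCount-split x b [] = refl
varCount-split x b ((z , d) ∷ c) with z ≟ x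
... | no _ = varCount-split x b c
... | yes _ = trans (cong suc (varCount-split x b c)) (one-sign d b)
  where
    one-sign : ∀ d b {m m′} → suc (m + m′) ≡ bit (does (d ≟ᵇ b)) + m + (bit (does (d ≟ᵇ not b)) + m′)
    one-sign true  true  = refl
    one-sign false false = refl
    one-sign true  false = sym (+-suc _ _)
    one-sign false true  = sym (+-suc _ _)

varCount-absent : (x : Fin n) (c : Clause n) → All (λ l → x ≢ proj₁ l) c → varCount x c ≡ 0
varCount-absent x [] [] = refl
varCount-absent x ((z , _) ∷ c) (x≢z ∷ x∉c) rewrite dec-false (z ≟ x) (x≢z ∘ sym) = varCount-absent x c x∉c

varCount≤1 : (x : Fin n) (c : Clause n) → Distinct c → varCount x c ≤ 1
varCount≤1 x [] [] = z≤n
varCount≤1 x ((z , _) ∷ c) (z∉c ∷ dist) with z ≟ x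
... | yes refl rewrite varCount-absent z c z∉c = s≤s z≤n
... | no _ = varCount≤1 x c dist

litCount-opposite≤1 : (x : Fin n) (b : Bool) (c : Clause n) → Distinct c →
                      litCount (x , b) c + litCount (x , not b) c ≤ 1
litCount-opposite≤1 x b c dist = subst (_≤ 1) (varCount-split x b c) (varCount≤1 x c dist)

litCount≤1 : (l : Lit n) (c : Clause n) → Distinct c → litCount l c ≤ 1
litCount≤1 (x , b) c dist = m+n≤o⇒m≤o _ (litCount-opposite≤1 x b c dist)

litCount-suc⇒∈ : (l : Lit n) (c : Clause n) {k : ℕ} → litCount l c ≡ suc k → l ∈ c
litCount-suc⇒∈ (x , b) ((z , d) ∷ c) count with z ≟ x | d ≟ᵇ b
... | yes refl | yes refl = here refl
... | yes _    | no _     = there (litCount-suc⇒∈ (x , b) c count)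
... | no _     | _        = there (litCount-suc⇒∈ (x , b) c count)

litCount-zero⇒∉ : (l : Lit n) (c : Clause n) → litCount l c ≡ 0 → l ∉ c
litCount-zero⇒∉ (x , b) ((z , d) ∷ c) count (there l∈c) = litCount-zero⇒∉ (x , b) c (m+n≡0⇒n≡0 _ count) l∈c
litCount-zero⇒∉ (x , b) ((x , b) ∷ c) count (here refl)
  rewrite dec-true (x ≟ x) refl | dec-true (b ≟ᵇ b) refl = case count of λ ()

freeLitCount-assign : (σ : PAssign n) (x : Fin n) (b : Bool) → σ x ≡ nothing → (c : Clause n) →
                      freeLitCount σ c ≡ varCount x c + freeLitCount (assign σ x b) c
freeLitCount-assign σ x b x-free [] = refl
freeLitCount-assign σ x b x-free ((z , _) ∷ c) with z ≟ x
... | yes refl rewrite x-free = cong suc (freeLitCount-assign σ z b x-free c)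
... | no _ = trans (cong (bit (is-nothing (σ z)) +_) (freeLitCount-assign σ x b x-free c))
                 (+-exchange (bit (is-nothing (σ z))) (varCount x c) _)

freeLitCount-empty : (c : Clause n) → freeLitCount empty c ≡ length c
freeLitCount-empty [] = refl
freeLitCount-empty (_ ∷ c) = cong suc (freeLitCount-empty c)

freeLitCount-assigned : (σ : PAssign n) → freeCount σ ≡ 0 → (c : Clause n) → freeLitCount σ c ≡ 0
freeLitCount-assigned σ count [] = refl
freeLitCount-assigned σ count ((z , _) ∷ c)
  rewrite countTrue-zero⇒ (is-nothing ∘ σ) count z = freeLitCount-assigned σ count c

Satisfies : PAssign n → Clause n → Set
Satisfies σ = Any (LitTrue σ)

satisfies? : (σ : PAssign n) (c : Clause n) → Dec (Satisfies σ c)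
satisfies? σ = any? λ (x , b) → ≡-decₘ _≟ᵇ_ (σ x) (just b)

LitTrue-assign⁺ : (σ : PAssign n) (x : Fin n) (b : Bool) → σ x ≡ nothing →
                  (l : Lit n) → LitTrue σ l → LitTrue (assign σ x b) l
LitTrue-assign⁺ σ x b x-free (z , d) holds with z ≟ x
... | yes refl = case trans (sym x-free) holds of λ ()
... | no _ = holds

LitTrue-assign⁻ : (σ : PAssign n) (x : Fin n) (b : Bool) (l : Lit n) →
                  LitTrue (assign σ x b) l → l ≡ (x , b) ⊎ LitTrue σ l
LitTrue-assign⁻ σ x b (z , d) holds with z ≟ x
... | yes refl = inj₁ (cong (z ,_) (sym (just-injective holds)))
... | no _ = inj₂ holds

Satisfies-assign⁺ : (σ : PAssign n) (x : Fin n) (b : Bool) → σ x ≡ nothing →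
                    (c : Clause n) → Satisfies σ c → Satisfies (assign σ x b) c
Satisfies-assign⁺ σ x b x-free c = Any.map (LitTrue-assign⁺ σ x b x-free _)

Satisfies-assign-∈ : (σ : PAssign n) (x : Fin n) (b : Bool) (c : Clause n) → (x , b) ∈ c → Satisfies (assign σ x b) c
Satisfies-assign-∈ σ x b c = Any.map λ { refl → assign-self σ x b }

Satisfies-assign⁻ : (σ : PAssign n) (x : Fin n) (b : Bool) (c : Clause n) → (x , b) ∉ c →
                    ¬ Satisfies σ c → ¬ Satisfies (assign σ x b) c
Satisfies-assign⁻ σ x b (l ∷ c) l∉ unsat (here holds) with LitTrue-assign⁻ σ x b l holds
... | inj₁ refl = l∉ (here refl)
... | inj₂ holds′ = unsat (here holds′)
Satisfies-assign⁻ σ x b (l ∷ c) l∉ unsat (there sat) =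
  Satisfies-assign⁻ σ x b c (l∉ ∘ there) (unsat ∘ there) sat

¬Satisfies-empty : (c : Clause n) → ¬ Satisfies empty c
¬Satisfies-empty (_ ∷ c) (there sat) = ¬Satisfies-empty c sat

freeLiterals : PAssign n → List (Lit n)
freeLiterals {n} σ =
  filter (λ l → ≡-decₘ _≟ᵇ_ (σ (proj₁ l)) nothing) (cartesianProduct (allFin n) (true ∷ false ∷ []))

∈-freeLiterals : (σ : PAssign n) {x : Fin n} (b : Bool) → σ x ≡ nothing → (x , b) ∈ freeLiterals σ
∈-freeLiterals σ {x} b x-free = ∈-filter⁺ _ (∈-cartesianProduct⁺ (∈-allFin x) (∈-Bool b)) x-free
  where
    ∈-Bool : (b : Bool) → b ∈ true ∷ false ∷ []
    ∈-Bool true = here refl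
    ∈-Bool false = there (here refl)

freeLiterals-free : (σ : PAssign n) → All (λ l → σ (proj₁ l) ≡ nothing) (freeLiterals σ)
freeLiterals-free {n} σ = all-filter _ (cartesianProduct (allFin n) (true ∷ false ∷ []))

-- Lower bound: a potential that F cannot increase

module Potential (w : ℕ → ℕ)
                 (w-decay₁ : ∀ t → 2 * w t ≤ 3 * w (suc t))
                 (w-decay₂ : ∀ t → w t ≤ 2 * w (suc (suc t))) where

  weight : PAssign n → Clause n → ℕ
  weight σ c = if does (satisfies? σ c) then 0 else w (freeLitCount σ c)

  potential : PAssign n → CNF n → ℕ
  potential σ = sum ∘ map (weight σ)

  pressureOn : PAssign n → Lit n → Clause n → ℕ
  pressureOn σ l c = litCount l c * weight σ c

  pressure : PAssign n → Lit n → CNF n → ℕ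
  pressure σ l = sum ∘ map (pressureOn σ l)

  weight-sat : (σ : PAssign n) (c : Clause n) → Satisfies σ c → weight σ c ≡ 0
  weight-sat σ c sat rewrite dec-true (satisfies? σ c) sat = refl

  weight-unsat : (σ : PAssign n) (c : Clause n) → ¬ Satisfies σ c → weight σ c ≡ w (freeLitCount σ c)
  weight-unsat σ c unsat rewrite dec-false (satisfies? σ c) unsat = refl

  w-decay : ∀ t {a a′} → a ≤ 1 → a′ ≤ 1 →
            let u = a + (a′ + t) in 2 * w t ≤ 2 * w u + (a * w u + a′ * w u)
  w-decay t z≤n       z≤n       = m≤m+n _ _
  w-decay t (s≤s z≤n) z≤n       = ≤-trans (w-decay₁ t) (≤-reflexive (three (w (suc t))))
    where three : ∀ v → 3 * v ≡ 2 * v + (1 * v + 0 * v)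
          three = solve-∀
  w-decay t z≤n       (s≤s z≤n) = ≤-trans (w-decay₁ t) (≤-reflexive (three (w (suc t))))
    where three : ∀ v → 3 * v ≡ 2 * v + (0 * v + 1 * v)
          three = solve-∀
  w-decay t (s≤s z≤n) (s≤s z≤n) = ≤-trans (*-monoʳ-≤ 2 (w-decay₂ t)) (≤-reflexive (four (w (suc (suc t)))))
    where four : ∀ v → 2 * (2 * v) ≡ 2 * v + (1 * v + 1 * v)
          four = solve-∀

  hit-bound : ∀ {a a′} v R → a ≤ 1 → a′ ≤ 1 → a * v + a′ * v ≤ 2 * v + R
  hit-bound {a} {a′} v R a≤1 a′≤1 = begin
    a * v + a′ * v ≤⟨ +-mono-≤ (*-monoˡ-≤ v a≤1) (*-monoˡ-≤ v a′≤1) ⟩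
    1 * v + 1 * v  ≡⟨ twice v ⟩
    2 * v          ≤⟨ m≤m+n _ R ⟩
    2 * v + R      ∎
    where
      open ≤-Reasoning
      twice : ∀ v → 1 * v + 1 * v ≡ 2 * v
      twice = solve-∀

  module Round {σ : PAssign n} {x y : Fin n} {b b′ : Bool}
               (x-free : σ x ≡ nothing) (y-free : assign σ x b y ≡ nothing) where

    σ₁ σ₂ : PAssign n
    σ₁ = assign σ x b
    σ₂ = assign σ₁ y b′

    freeLitCount-round : (c : Clause n) → litCount (x , b) c ≡ 0 → litCount (y , b′) c ≡ 0 →
      freeLitCount σ c ≡ litCount (x , not b) c + (litCount (y , not b′) c + freeLitCount σ₂ c)
    freeLitCount-round c x-misses y-misses = begin
      freeLitCount σ c
        ≡⟨ freeLitCount-assign σ x b x-free c ⟩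
      varCount x c + freeLitCount σ₁ c
        ≡⟨ cong (varCount x c +_) (freeLitCount-assign σ₁ y b′ y-free c) ⟩
      varCount x c + (varCount y c + freeLitCount σ₂ c)
        ≡⟨ cong₂ (λ p q → p + (q + freeLitCount σ₂ c))
                 (trans (varCount-split x b c) (cong (_+ litCount (x , not b) c) x-misses))
                 (trans (varCount-split y b′ c) (cong (_+ litCount (y , not b′) c) y-misses)) ⟩
      litCount (x , not b) c + (litCount (y , not b′) c + freeLitCount σ₂ c) ∎
      where open ≡-Reasoning

    -- A clause containing x = b or y = b′ becomes satisfied and is paid for by the pressure
    -- terms on the left; otherwise each move removes at most one free literal, of the
    -- opposite sign, and w-decay pays for that.
    round-clause : (c : Clause n) → Distinct c →
      2 * weight σ₂ c + (litCount (x , b) c * weight σ c + litCount (y , b′) c * weight σ c)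
        ≤ 2 * weight σ c + (litCount (x , not b) c * weight σ c + litCount (y , not b′) c * weight σ c)
    round-clause c dist with satisfies? σ c
    ... | yes sat
      rewrite weight-sat σ₂ c (Satisfies-assign⁺ σ₁ y b′ y-free c (Satisfies-assign⁺ σ x b x-free c sat))
            | *-zeroʳ (litCount (x , b) c) | *-zeroʳ (litCount (y , b′) c) = z≤n
    ... | no unsat with litCount (x , b) c in x-hits | litCount (y , b′) c in y-hits
    ...   | suc _ | _ rewrite weight-sat σ₂ c (Satisfies-assign⁺ σ₁ y b′ y-free c
                               (Satisfies-assign-∈ σ x b c (litCount-suc⇒∈ (x , b) c x-hits)))
      = hit-bound _ _ (subst (_≤ 1) x-hits (litCount≤1 (x , b) c dist))
                      (subst (_≤ 1) y-hits (litCount≤1 (y , b′) c dist))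
    ...   | zero | suc _
      rewrite weight-sat σ₂ c (Satisfies-assign-∈ σ₁ y b′ c (litCount-suc⇒∈ (y , b′) c y-hits))
      = hit-bound _ _ z≤n (subst (_≤ 1) y-hits (litCount≤1 (y , b′) c dist))
    ...   | zero | zero
      rewrite weight-unsat σ₂ c (Satisfies-assign⁻ σ₁ y b′ c (litCount-zero⇒∉ (y , b′) c y-hits)
                                  (Satisfies-assign⁻ σ x b c (litCount-zero⇒∉ (x , b) c x-hits) unsat))
            | freeLitCount-round c x-hits y-hits
      = ≤-trans (≤-reflexive (+-identityʳ _))
          (w-decay (freeLitCount σ₂ c)
             (subst (λ m → m + litCount (x , not b) c ≤ 1) x-hits (litCount-opposite≤1 x b c dist))
             (subst (λ m → m + litCount (y , not b′) c ≤ 1) y-hits (litCount-opposite≤1 y b′ c dist)))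

    round-potential : (φ : CNF n) → All Distinct φ →
      2 * potential σ₂ φ + (pressure σ (x , b) φ + pressure σ (y , b′) φ)
        ≤ 2 * potential σ φ + (pressure σ (x , not b) φ + pressure σ (y , not b′) φ)
    round-potential φ dists =
      round-sum (weight σ₂) (weight σ) (pressureOn σ (x , b)) (pressureOn σ (y , b′))
                (pressureOn σ (x , not b)) (pressureOn σ (y , not b′)) φ (All.map (round-clause _) dists)

    potential-round : (φ : CNF n) → All Distinct φ →
      pressure σ (x , not b) φ + pressure σ (y , not b′) φ ≤ pressure σ (x , b) φ + pressure σ (y , b′) φ →
      potential σ₂ φ ≤ potential σ φ
    potential-round φ dists balanced = *-cancelˡ-≤ 2 (+-cancelʳ-≤ _ _ _
      (≤-trans (round-potential φ dists) (+-monoʳ-≤ (2 * potential σ φ) balanced)))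

  gain : PAssign n → CNF n → Lit n → ℤ
  gain σ φ l = ℤ.+ pressure σ l φ ℤ.- ℤ.+ pressure σ (neg l) φ

  GreedyMove : PAssign n → CNF n → Lit n → Set
  GreedyMove σ φ (x , b) = σ x ≡ nothing ×
    (∀ {y} b′ → σ y ≡ nothing →
       pressure σ (x , not b) φ + pressure σ (y , not b′) φ ≤ pressure σ (x , b) φ + pressure σ (y , b′) φ)

  greedyMove : (σ : PAssign n) (φ : CNF n) {c : ℕ} → freeCount σ ≡ suc c → ∃ (GreedyMove σ φ)
  greedyMove {n = n} σ φ count with freeCount-suc⇒free σ count
  ... | i , i-free = l , l-free , balanced
    where
      l : Lit n
      l = argmax (gain σ φ) (i , true) (freeLiterals σ)
      l-free : σ (proj₁ l) ≡ nothing
      l-free = argmax-all (gain σ φ) {P = λ l → σ (proj₁ l) ≡ nothing} i-free (freeLiterals-free σ)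
      -- l beats the free literal (y , not b′), whose negation is (y , b′).
      balanced : ∀ {y} b′ → σ y ≡ nothing →
                 pressure σ (neg l) φ + pressure σ (y , not b′) φ ≤ pressure σ l φ + pressure σ (y , b′) φ
      balanced {y} b′ y-free =
        subst (λ d → pressure σ (neg l) φ + pressure σ (y , not b′) φ ≤ pressure σ l φ + pressure σ (y , d) φ)
              (not-involutive b′)
              (ℤ-diff-≤⇒ (pressure σ (y , not b′) φ) (pressure σ (neg (y , not b′)) φ)
                         (pressure σ l φ) (pressure σ (neg l) φ)
                 (All.lookup (f[xs]≤f[argmax] {f = gain σ φ} (i , true) (freeLiterals σ))
                             (∈-freeLiterals σ (not b′) y-free)))

  potential<w0⇒Sat : (σ : PAssign n) → freeCount σ ≡ 0 → (φ : CNF n) → potential σ φ < w 0 → Sat σ φ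
  potential<w0⇒Sat σ count [] small = []
  potential<w0⇒Sat σ count (c ∷ φ) small with satisfies? σ c
  ... | yes sat = sat ∷ potential<w0⇒Sat σ count φ small
  ... | no _ rewrite freeLitCount-assigned σ count c = contradiction small (m+n≮m (w 0) _)

  F-loses : (φ : CNF n) → All Distinct φ → ∀ r (σ : PAssign n) → freeCount σ ≡ double r →
            potential σ φ < w 0 → ¬ FWins φ (double r) T σ
  F-loses φ dists zero σ count small F-wins = F-wins (potential<w0⇒Sat σ count φ small)
  F-loses φ dists (suc r) σ count small F-wins =
    let (x , b) , x-free , balanced = greedyMove σ φ count
        y , b′ , y-free , F-wins′    = F-wins x b x-free
    in F-loses φ dists r (assign (assign σ x b) y b′) (freeCount-round σ count x-free y-free)
         (≤-<-trans (Round.potential-round x-free y-free φ dists (balanced b′ (assign-free⁻ σ x b y-free))) small)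
         F-wins′

  potential-empty : {k : ℕ} (φ : CNF n) → Uniform k φ → potential empty φ ≡ length φ * w k
  potential-empty [] [] = refl
  potential-empty (c ∷ φ) ((len , _) ∷ uniform) =
    cong₂ _+_ (trans (weight-unsat empty c (¬Satisfies-empty c)) (cong w (trans (freeLitCount-empty c) len)))
              (potential-empty φ uniform)

  F-wins⇒bound : {k : ℕ} (I : InstanceTF k) → FWinsTF I → w 0 ≤ size I * w k
  F-wins⇒bound I F-wins = subst (w 0 ≤_) (potential-empty (φ I) (uniform I)) (≮⇒≥ λ small →
    F-loses (φ I) (All.map proj₂ (uniform I)) (suc (m I)) empty
            (trans freeCount-empty (2*≡double (suc (m I)))) small
            (subst (λ r → FWins (φ I) r T empty) (2*≡double (suc (m I))) F-wins))

-- W j t = 3·2^(j−s) for t = 2s and 2·2^(j−s) for t = 2s+1 while s ≤ j; beyond t = 2j+1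
-- the truncated `pred` makes it alternate 3, 2, 3, … which keeps both decay inequalities.
W : ℕ → ℕ → ℕ
W j zero = 3 * 2 ^ j
W j (suc zero) = 2 * 2 ^ j
W j (suc (suc t)) = W (pred j) t

W-decay₁ : ∀ j t → 2 * W j t ≤ 3 * W j (suc t)
W-decay₁ j zero = ≤-reflexive (swap23 (2 ^ j))
  where swap23 : ∀ p → 2 * (3 * p) ≡ 3 * (2 * p)
        swap23 = solve-∀
W-decay₁ zero (suc zero) = m≤m+n 4 5
W-decay₁ (suc j) (suc zero) = begin
  2 * (2 * (2 * 2 ^ j)) ≡⟨ eight (2 ^ j) ⟩
  8 * 2 ^ j             ≤⟨ *-monoˡ-≤ (2 ^ j) (n≤1+n 8) ⟩
  9 * 2 ^ j             ≡⟨ nine (2 ^ j) ⟩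
  3 * (3 * 2 ^ j)       ∎
  where
    open ≤-Reasoning
    eight : ∀ p → 2 * (2 * (2 * p)) ≡ 8 * p
    eight = solve-∀
    nine : ∀ p → 9 * p ≡ 3 * (3 * p)
    nine = solve-∀
W-decay₁ j (suc (suc t)) = W-decay₁ (pred j) t

W-decay₂ : ∀ j t → W j t ≤ 2 * W j (suc (suc t))
W-decay₂ zero zero = m≤m+n 3 3
W-decay₂ (suc j) zero = ≤-reflexive (swap23 (2 ^ j))
  where swap23 : ∀ p → 3 * (2 * p) ≡ 2 * (3 * p)
        swap23 = solve-∀
W-decay₂ zero (suc zero) = m≤m+n 2 2
W-decay₂ (suc j) (suc zero) = ≤-refl
W-decay₂ j (suc (suc t)) = W-decay₂ (pred j) t

W-even : ∀ j → W j (double j) ≡ 3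
W-even zero = refl
W-even (suc j) = W-even j

W-odd : ∀ j → W j (suc (double j)) ≡ 2
W-odd zero = refl
W-odd (suc j) = W-odd j

open Potential using (F-wins⇒bound)

F-wins⇒W-bound : ∀ j {k} (I : InstanceTF k) → FWinsTF I → 3 * 2 ^ j ≤ size I * W j k
F-wins⇒W-bound j = F-wins⇒bound (W j) (W-decay₁ j) (W-decay₂ j)

-- Upper bound: the mirror strategy

module Construction (P : ℕ) where

  X Y : Fin P → Fin (2 * P)
  X i = i ↑ˡ (P + 0)
  Y i = P ↑ʳ (i ↑ˡ 0)

  index : Fin (2 * P) → Fin P
  index v = [ id , [ id , (λ ()) ] ∘ splitAt P ] (splitAt P v)

  index-X : ∀ i → index (X i) ≡ i
  index-X i = cong [ id , [ id , (λ ()) ] ∘ splitAt P ] (splitAt-↑ˡ P i (P + 0))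

  index-Y : ∀ i → index (Y i) ≡ i
  index-Y i rewrite splitAt-↑ʳ P (P + 0) (i ↑ˡ 0) | splitAt-↑ˡ P i 0 = refl

  X-injective : ∀ {i i′} → X i ≡ X i′ → i ≡ i′
  X-injective {i} {i′} eq = trans (sym (index-X i)) (trans (cong index eq) (index-X i′))

  Y-injective : ∀ {i i′} → Y i ≡ Y i′ → i ≡ i′
  Y-injective {i} {i′} eq = trans (sym (index-Y i)) (trans (cong index eq) (index-Y i′))

  X≢Y : ∀ {i i′} → X i ≢ Y i′
  X≢Y {i} {i′} eq
    with () ← trans (sym (splitAt-↑ˡ P i (P + 0))) (trans (cong (splitAt P) eq) (splitAt-↑ʳ P (P + 0) (i′ ↑ˡ 0)))

  X-or-Y : (v : Fin (2 * P)) → (∃ λ i → v ≡ X i) ⊎ (∃ λ i → v ≡ Y i)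
  X-or-Y v with splitAt P v in eq
  ... | inj₁ i = inj₁ (i , sym (splitAt⁻¹-↑ˡ eq))
  ... | inj₂ u with splitAt P u in eq′
  ...   | inj₁ i = inj₂ (i , sym (trans (cong (P ↑ʳ_) (splitAt⁻¹-↑ˡ eq′)) (splitAt⁻¹-↑ʳ eq)))

  Block : Set
  Block = Fin P × Bool

  blockClause : Block → Bool → Clause (2 * P)
  blockClause (i , true)  s = (X i , s) ∷ (Y i , not s) ∷ []
  blockClause (i , false) s = (X i , s) ∷ []

  blockWidth : Block → ℕ
  blockWidth (_ , true)  = 2
  blockWidth (_ , false) = 1

  width : List Block → ℕ
  width = sum ∘ map blockWidth

  blockFormula : List Block → CNF (2 * P)
  blockFormula [] = [] ∷ []
  blockFormula (g ∷ gs) = map (blockClause g true ++_) (blockFormula gs) ++ map (blockClause g false ++_) (blockFormula gs)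

  Fresh : List Block → Set
  Fresh = AllPairs (λ g g′ → proj₁ g ≢ proj₁ g′)

  _∈ᵢ_ : Fin P → List Block → Set
  i ∈ᵢ gs = Any (λ g → i ≡ proj₁ g) gs

  blockFormula-∷⁺ : {Q : Clause (2 * P) → Set} (g : Block) (gs : List Block) →
    (∀ s {c} → c ∈ blockFormula gs → Q (blockClause g s ++ c)) → All Q (blockFormula (g ∷ gs))
  blockFormula-∷⁺ g gs q = Allₚ.++⁺ (Allₚ.map⁺ (All.tabulate (q true))) (Allₚ.map⁺ (All.tabulate (q false)))

  length-blockFormula : (gs : List Block) → length (blockFormula gs) ≡ 2 ^ length gs
  length-blockFormula [] = refl
  length-blockFormula (g ∷ gs) = begin
    length (map (blockClause g true ++_) fs ++ map (blockClause g false ++_) fs)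
      ≡⟨ length-++ (map (blockClause g true ++_) fs) ⟩
    length (map (blockClause g true ++_) fs) + length (map (blockClause g false ++_) fs)
      ≡⟨ cong₂ _+_ (length-map (blockClause g true ++_) fs) (length-map (blockClause g false ++_) fs) ⟩
    length fs + length fs ≡⟨ cong (λ m → m + m) (length-blockFormula gs) ⟩
    2 ^ length gs + 2 ^ length gs ≡⟨ cong (2 ^ length gs +_) (+-identityʳ _) ⟨
    2 ^ suc (length gs) ∎
    where
      open ≡-Reasoning
      fs : CNF (2 * P)
      fs = blockFormula gs

  length-blockClause : (g : Block) (s : Bool) → length (blockClause g s) ≡ blockWidth g
  length-blockClause (_ , true)  s = refl
  length-blockClause (_ , false) s = refl

  blockFormula-width : (gs : List Block) → All (λ c → length c ≡ width gs) (blockFormula gs)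
  blockFormula-width [] = refl ∷ []
  blockFormula-width (g ∷ gs) = blockFormula-∷⁺ g gs λ s {c} c∈ →
    trans (length-++ (blockClause g s)) (cong₂ _+_ (length-blockClause g s) (All.lookup (blockFormula-width gs) c∈))

  blockClause-index : (g : Block) (s : Bool) → All (λ l → index (proj₁ l) ≡ proj₁ g) (blockClause g s)
  blockClause-index (i , true)  s = index-X i ∷ index-Y i ∷ []
  blockClause-index (i , false) s = index-X i ∷ []

  blockFormula-index : (gs : List Block) → All (All (λ l → index (proj₁ l) ∈ᵢ gs)) (blockFormula gs)
  blockFormula-index [] = [] ∷ []
  blockFormula-index (g ∷ gs) = blockFormula-∷⁺ g gs λ s c∈ →
    Allₚ.++⁺ (All.map here (blockClause-index g s)) (All.map there (All.lookup (blockFormula-index gs) c∈))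

  fresh-apart : ∀ {i gs} {u v : Fin (2 * P)} → All (λ g′ → i ≢ proj₁ g′) gs →
                index u ≡ i → index v ∈ᵢ gs → u ≢ v
  fresh-apart fresh u∈g v∈gs refl = All¬⇒¬Any fresh (subst (_∈ᵢ _) u∈g v∈gs)

  blockClause-distinct : (g : Block) (s : Bool) → Distinct (blockClause g s)
  blockClause-distinct (i , true)  s = (X≢Y ∷ []) ∷ [] ∷ []
  blockClause-distinct (i , false) s = [] ∷ []

  blockFormula-distinct : (gs : List Block) → Fresh gs → All Distinct (blockFormula gs)
  blockFormula-distinct [] _ = [] ∷ []
  blockFormula-distinct (g ∷ gs) (fresh ∷ freshs) = blockFormula-∷⁺ g gs λ s c∈ →
    AllPairsₚ.++⁺ (blockClause-distinct g s) (All.lookup (blockFormula-distinct gs freshs) c∈)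
      (All.map (λ u∈g → All.map (fresh-apart fresh u∈g) (All.lookup (blockFormula-index gs) c∈))
               (blockClause-index g s))

  Separated : List Block → Clause (2 * P) → Clause (2 * P) → Set
  Separated gs c d = ∃ λ l → l ∈ c × l ∉ d × index (proj₁ l) ∈ᵢ gs

  X-true∉blockClause-false : (g : Block) → (X (proj₁ g) , true) ∉ blockClause g false
  X-true∉blockClause-false (i , true)  (there (here eq)) = X≢Y (cong proj₁ eq)
  X-true∉blockClause-false (i , false) (there ())

  blockFormula-separated : (gs : List Block) → Fresh gs → AllPairs (Separated gs) (blockFormula gs)
  blockFormula-separated [] _ = [] ∷ []
  blockFormula-separated (g ∷ gs) (fresh ∷ freshs) =
    AllPairsₚ.++⁺ (AllPairsₚ.map⁺ (AllPairs.map (same-sign true) separated))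
                  (AllPairsₚ.map⁺ (AllPairs.map (same-sign false) separated))
                  (Allₚ.map⁺ (All.tabulate λ _ → Allₚ.map⁺ (All.tabulate opposite-signs)))
    where
      separated = blockFormula-separated gs freshs

      same-sign : ∀ s {c d} → Separated gs c d → Separated (g ∷ gs) (blockClause g s ++ c) (blockClause g s ++ d)
      same-sign s {c} {d} (l , l∈c , l∉d , l∈gs) = l , ∈-++⁺ʳ (blockClause g s) l∈c , l∉ , there l∈gs
        where
          l∉ : l ∉ blockClause g s ++ d
          l∉ l∈ with ∈-++⁻ (blockClause g s) l∈
          ... | inj₁ l∈g = fresh-apart fresh (All.lookup (blockClause-index g s) l∈g) l∈gs refl
          ... | inj₂ l∈d = l∉d l∈d

      opposite-signs : ∀ {c d} → d ∈ blockFormula gs →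
                       Separated (g ∷ gs) (blockClause g true ++ c) (blockClause g false ++ d)
      opposite-signs {c} {d} d∈ = (X (proj₁ g) , true) , X∈ g , X∉ , here (index-X (proj₁ g))
        where
          X∈ : ∀ g → (X (proj₁ g) , true) ∈ blockClause g true ++ c
          X∈ (_ , true)  = here refl
          X∈ (_ , false) = here refl
          X∉ : (X (proj₁ g) , true) ∉ blockClause g false ++ d
          X∉ X∈ with ∈-++⁻ (blockClause g false) X∈
          ... | inj₁ X∈g = X-true∉blockClause-false g X∈g
          ... | inj₂ X∈d =
            fresh-apart fresh (index-X (proj₁ g)) (All.lookup (All.lookup (blockFormula-index gs) d∈) X∈d) refl

  blockFormula-clauseSet : (gs : List Block) → Fresh gs → ClauseSet (blockFormula gs)
  blockFormula-clauseSet gs fresh =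
    AllPairs.map (λ (_ , l∈c , l∉d , _) c↭d → l∉d (∈-resp-↭ c↭d l∈c)) (blockFormula-separated gs fresh)

  clauseOf : (Fin P → Bool) → List Block → Clause (2 * P)
  clauseOf s [] = []
  clauseOf s (g ∷ gs) = blockClause g (s (proj₁ g)) ++ clauseOf s gs

  clauseOf-∈ : (s : Fin P → Bool) (gs : List Block) → clauseOf s gs ∈ blockFormula gs
  clauseOf-∈ s [] = here refl
  clauseOf-∈ s (g ∷ gs) with s (proj₁ g)
  ... | true  = ∈-++⁺ˡ (∈-map⁺ (blockClause g true ++_) (clauseOf-∈ s gs))
  ... | false = ∈-++⁺ʳ _ (∈-map⁺ (blockClause g false ++_) (clauseOf-∈ s gs))

  Mirrored : PAssign (2 * P) → Set
  Mirrored σ = ∀ i → σ (Y i) ≡ Maybe.map not (σ (X i))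

  -- The value at an unassigned X i is junk; it is only used on complete assignments.
  refuting : PAssign (2 * P) → Fin P → Bool
  refuting σ i = Maybe.maybe not true (σ (X i))

  clauseOf-refuted : (σ : PAssign (2 * P)) → Mirrored σ → freeCount σ ≡ 0 → (gs : List Block) →
                     All (λ l → ¬ LitTrue σ l) (clauseOf (refuting σ) gs)
  clauseOf-refuted σ mirrored assigned [] = []
  clauseOf-refuted σ mirrored assigned ((i , k) ∷ gs) =
    Allₚ.++⁺ (block-refuted k) (clauseOf-refuted σ mirrored assigned gs)
    where
      X-false : ∀ {v} → σ (X i) ≡ just v → ¬ LitTrue σ (X i , not v)
      X-false X-value holds = not-¬ refl (just-injective (trans (sym X-value) holds))

      Y-false : ∀ {v} → σ (X i) ≡ just v → ¬ LitTrue σ (Y i , not (not v))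
      Y-false X-value holds =
        not-¬ refl (just-injective (trans (sym (trans (mirrored i) (cong (Maybe.map not) X-value))) holds))

      block-refuted : ∀ k → All (λ l → ¬ LitTrue σ l) (blockClause (i , k) (refuting σ i))
      block-refuted k with σ (X i) in X-value | countTrue-zero⇒ (is-nothing ∘ σ) assigned (X i)
      block-refuted true  | just v | _ = X-false X-value ∷ Y-false X-value ∷ []
      block-refuted false | just v | _ = X-false X-value ∷ []
      block-refuted _     | nothing | ()

  Mirrored-free : (σ : PAssign (2 * P)) → Mirrored σ → ∀ i → σ (Y i) ≡ nothing → σ (X i) ≡ nothing
  Mirrored-free σ mirrored i Y-free with σ (X i) | trans (sym Y-free) (mirrored i)
  ... | nothing | _  = refl
  ... | just _  | ()

  Mirrored-XY : (σ : PAssign (2 * P)) (i : Fin P) (b : Bool) → Mirrored σ →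
                Mirrored (assign (assign σ (X i) b) (Y i) (not b))
  Mirrored-XY σ i b mirrored i′ with i′ ≟ i
  ... | yes refl = trans (assign-self σ₁ (Y i) (not b))
                         (cong (Maybe.map not) (sym (trans (assign-other σ₁ (Y i) (not b) X≢Y) (assign-self σ (X i) b))))
    where σ₁ = assign σ (X i) b
  ... | no i′≢i = trans (assign-other₂ σ (X≢Y ∘ sym) (i′≢i ∘ Y-injective))
                        (trans (mirrored i′) (cong (Maybe.map not) (sym (assign-other₂ σ (i′≢i ∘ X-injective) X≢Y))))

  Mirrored-YX : (σ : PAssign (2 * P)) (i : Fin P) (b : Bool) → Mirrored σ →
                Mirrored (assign (assign σ (Y i) b) (X i) (not b))
  Mirrored-YX σ i b mirrored i′ with i′ ≟ i
  ... | yes refl = trans (trans (assign-other σ₁ (X i) (not b) (X≢Y ∘ sym)) (assign-self σ (Y i) b))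
                         (trans (cong just (sym (not-involutive b)))
                                (cong (Maybe.map not) (sym (assign-self σ₁ (X i) (not b)))))
    where σ₁ = assign σ (Y i) b
  ... | no i′≢i = trans (assign-other₂ σ (i′≢i ∘ Y-injective) (X≢Y ∘ sym))
                        (trans (mirrored i′) (cong (Maybe.map not) (sym (assign-other₂ σ X≢Y (i′≢i ∘ X-injective)))))

  mirror-wins : (gs : List Block) (r : ℕ) (σ : PAssign (2 * P)) → freeCount σ ≡ double r → Mirrored σ →
                FWins (blockFormula gs) (double r) T σ
  mirror-wins gs zero σ assigned mirrored sat =
    All¬⇒¬Any (clauseOf-refuted σ mirrored assigned gs) (All.lookup sat (clauseOf-∈ (refuting σ) gs))
  mirror-wins gs (suc r) σ count mirrored v b v-free with X-or-Y v
  ... | inj₁ (i , refl) =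
    Y i , not b , Y-free , mirror-wins gs r _ (freeCount-round σ count v-free Y-free) (Mirrored-XY σ i b mirrored)
    where
      Y-free : assign σ (X i) b (Y i) ≡ nothing
      Y-free = trans (assign-other σ (X i) b (X≢Y ∘ sym)) (trans (mirrored i) (cong (Maybe.map not) v-free))
  ... | inj₂ (i , refl) =
    X i , not b , X-free , mirror-wins gs r _ (freeCount-round σ count v-free X-free) (Mirrored-YX σ i b mirrored)
    where
      X-free : assign σ (Y i) b (X i) ≡ nothing
      X-free = trans (assign-other σ (Y i) b X≢Y) (Mirrored-free σ mirrored i v-free)

module Instances (j : ℕ) where
  open Construction (suc j)

  block-instance : (gs : List Block) → Fresh gs → {k : ℕ} → width gs ≡ k →
                   Σ (InstanceTF k) λ I → FWinsTF I × size I ≡ 2 ^ length gs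
  block-instance gs fresh refl = I , F-wins , length-blockFormula gs
    where
      I : InstanceTF (width gs)
      I = record
        { m         = j
        ; φ         = blockFormula gs
        ; uniform   = All.zip (blockFormula-width gs , blockFormula-distinct gs fresh)
        ; clauseSet = blockFormula-clauseSet gs fresh
        }
      F-wins : FWinsTF I
      F-wins = subst (λ r → FWins (blockFormula gs) r T empty) (sym (2*≡double (suc j)))
        (mirror-wins gs (suc j) empty (trans freeCount-empty (2*≡double (suc j))) λ _ → refl)

  pairBlock : Fin j → Block
  pairBlock i = suc i , true

  pairBlocks : List Block
  pairBlocks = tabulate pairBlock

  width-pairs : ∀ {l} (f : Fin l → Fin (suc j)) → width (tabulate λ i → f i , true) ≡ double l
  width-pairs {zero} f = refl
  width-pairs {suc l} f = cong (2 +_) (width-pairs (f ∘ suc))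

  pairBlocks-fresh : Fresh pairBlocks
  pairBlocks-fresh = AllPairsₚ.tabulate⁺ λ i≢i′ eq → i≢i′ (Fin.suc-injective eq)

  even-upper : Σ (InstanceTF (2 * j)) λ I → FWinsTF I × size I ≡ 2 ^ j
  even-upper with block-instance pairBlocks pairBlocks-fresh (trans (width-pairs suc) (sym (2*≡double j)))
  ... | I , F-wins , size≡ = I , F-wins , trans size≡ (cong (2 ^_) (length-tabulate pairBlock))

  odd-upper : Σ (InstanceTF (2 * j + 1)) λ I → FWinsTF I × size I ≤ 2 ^ suc j
  odd-upper with block-instance ((zero , false) ∷ pairBlocks) (Allₚ.tabulate⁺ (λ _ ()) ∷ pairBlocks-fresh)
                   (trans (cong suc (trans (width-pairs suc) (sym (2*≡double j)))) (+-comm 1 (2 * j)))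
  ... | I , F-wins , size≡ =
    I , F-wins , ≤-reflexive (trans size≡ (cong (λ l → 2 ^ suc l) (length-tabulate pairBlock)))

  even-lower : (I : InstanceTF (2 * j)) → FWinsTF I → 2 ^ j ≤ size I
  even-lower I F-wins = *-cancelˡ-≤ 3 (begin
    3 * 2 ^ j               ≤⟨ F-wins⇒W-bound j I F-wins ⟩
    size I * W j (2 * j)    ≡⟨ cong (λ t → size I * W j t) (2*≡double j) ⟩
    size I * W j (double j) ≡⟨ cong (size I *_) (W-even j) ⟩
    size I * 3              ≡⟨ *-comm (size I) 3 ⟩
    3 * size I              ∎)
    where open ≤-Reasoning

  odd-lower : (I : InstanceTF (2 * j + 1)) → FWinsTF I → 3 * 2 ^ j ≤ 2 * size I
  odd-lower I F-wins = begin
    3 * 2 ^ j                     ≤⟨ F-wins⇒W-bound j I F-wins ⟩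
    size I * W j (2 * j + 1)      ≡⟨ cong (λ t → size I * W j t) (trans (+-comm (2 * j) 1) (cong suc (2*≡double j))) ⟩
    size I * W j (suc (double j)) ≡⟨ cong (size I *_) (W-odd j) ⟩
    size I * 2                    ≡⟨ *-comm (size I) 2 ⟩
    2 * size I                    ∎
    where open ≤-Reasoning

open Instances

theorem1 : ((j : ℕ) → IsMTF (2 * j) (2 ^ j))
    × ((j : ℕ) → (Σ (InstanceTF (2 * j + 1)) λ I → FWinsTF I × size I ≤ 2 ^ (suc j))
                 × ((I : InstanceTF (2 * j + 1)) → FWinsTF I → 3 * 2 ^ j ≤ 2 * size I))
theorem1 = (λ j → even-upper j , even-lower j) , (λ j → odd-upper j , odd-lower j)
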